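{- Let $P$ be the definite logic program consisting of the four clauses $pqs(0,\_,\_,\_).$ $pqs(s(I),Cs,Us,[\_|Ds]) \leftarrow pqs(I,Cs,[\_|Us],Ds),\ pq(s(I),Cs,Us,Ds).$ $pq(I,[I|\_],[I|\_],[I|\_]).$ $pq(I,[\_|Cs],[\_|Us],[\_|Ds]) \leftarrow pq(I,Cs,Us,Ds).$ Then $P$ is correct w.r.t. the specification $S=S_{pq}\cup S_{pqs}$, i.e. $\mathcal{M}_P\subseteq S$, where $S_{pq}=\{\,pq(i,[c_1,\ldots,c_k,i|c],[u_1,\ldots,u_k,i|u],[d_1,\ldots,d_k,i|d])\in\mathcal{HB}\mid k\geq 0\,\}$ and $S_{pqs}=\{\,pqs(0,cs,us,ds)\mid cs,us,ds\in\mathcal{HU}\,\}\ \cup\ \{\,pqs(i,cs,us,[t|ds])\in\mathcal{HB}\mid i>0,\ 1,\ldots,i \text{ are members of } cs, \text{ and if } cs \text{ is a list of distinct members then } (cs,us,ds) \text{ is correct up to } i \text{ w.r.t. } i\,\}$ (here $i$ ranges over natural numbers, identified with the terms $s^i(0)$).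
   Context: Programs are definite clause programs over a fixed alphabet of function symbols (including $0$, $s$, and the list constructors $[\,]$, $[\cdot|\cdot]$) and predicate symbols (including $pq$, $pqs$, each of arity 4); "_" denotes an anonymous variable. $\mathcal{HU}$ is the Herbrand universe (set of ground terms), $\mathcal{HB}$ the Herbrand base, and $\mathcal{M}_P$ the least Herbrand model of $P$. A specification is a set $S\subseteq\mathcal{HB}$; $P$ is correct w.r.t. $S$ when $\mathcal{M}_P\subseteq S$. Prolog list notation is used: $[e_1,\ldots,e_n|e]$ stands for $e$ when $n=0$; a list of length $n$ is a term $[e_1,\ldots,e_n]$. A term $e$ is the $k$-th member ($k>0$) of a term $t$ if $t=[e_1,\ldots,e_{k-1},e|e']$ for some terms $e_1,\ldots,e_{k-1},e'$; $e$ is a member of $t$ if it is its $k$-th member for some $k>0$. A list of distinct members is a list whose members are pairwise distinct. If a number $j$ is the $k$-th member of a list $cs$, the up diagonal number of $j$ w.r.t. $i$ in $cs$ is $k+j-i$ and the down diagonal number is $k+i-j$. A triple of terms $(cs,us,ds)$ is correct up to $m$ w.r.t. $i$ when $0\leq m\leq i$ and: $cs$ is a list of distinct members and each $j\in\{1,\ldots,m\}$ is a member of $cs$; the up diagonal numbers of $1,\ldots,m$ in $cs$ are pairwise distinct, and so are the down diagonal numbers; and for each $j\in\{1,\ldots,m\}$, if the up (respectively down) diagonal number of $j$ w.r.t. $i$ in $cs$ is $l>0$ then the $l$-th member of $us$ (respectively $ds$) is $j$. -}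

module Defs where

open import Data.Nat using (ℕ; zero; suc; _≤_; _<_)
open import Data.Integer as ℤ using (ℤ; +_)
open import Data.List using (List)
open import Data.Product using (Σ; ∃; _×_; _,_)
open import Data.Sum using (_⊎_)
open import Relation.Binary.PropositionalEquality using (_≡_; _≢_)

-- Herbrand universe: ground terms over an alphabet containing
-- 0, s, [] and [.|.], plus (possibly) further function symbols,
-- represented by  fn f args  (symbol name f, argument list args).

data Term : Set where
  z    : Term
  s    : Term → Term
  nil  : Term
  cons : Term → Term → Term
  fn   : ℕ → List Term → Term

num : ℕ → Term
num zero    = z
num (suc n) = s (num n)

-- Herbrand base atoms with predicate symbols pq and pqs (arity 4).
-- (Atoms of other predicates are in neither M_P nor S.)

data Atom : Set where
  pq  : Term → Term → Term → Term → Atom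
  pqs : Term → Term → Term → Term → Atom

-- Least Herbrand model of P: the atoms derivable from ground instances
-- of the four clauses (anonymous variables range over all of HU).

data M : Atom → Set where
  pq-fact : ∀ i c u d → M (pq i (cons i c) (cons i u) (cons i d))
  pq-rule : ∀ i x cs y us w ds → M (pq i cs us ds)
          → M (pq i (cons x cs) (cons y us) (cons w ds))
  pqs-fact : ∀ a b c → M (pqs z a b c)
  pqs-rule : ∀ i cs us ds x y → M (pqs i cs (cons x us) ds)
           → M (pq (s i) cs us ds)
           → M (pqs (s i) cs us (cons y ds))

data KthMember : ℕ → Term → Term → Set where
  here  : ∀ e t → KthMember 1 e (cons e t)
  there : ∀ {k e t} x → KthMember k e t → KthMember (suc k) e (cons x t)

Member : Term → Term → Set
Member e t = Σ ℕ λ k → KthMember k e t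

data IsList : Term → Set where
  nil  : IsList nil
  cons : ∀ e t → IsList t → IsList (cons e t)

DistinctList : Term → Set
DistinctList cs = IsList cs ×
  (∀ k k' e e' → KthMember k e cs → KthMember k' e' cs → k ≢ k' → e ≢ e')

upDiag : ℕ → ℕ → ℕ → ℤ
upDiag k j i = (+ k ℤ.+ + j) ℤ.- + i

downDiag : ℕ → ℕ → ℕ → ℤ
downDiag k j i = (+ k ℤ.+ + i) ℤ.- + j

InRange : ℕ → ℕ → Set
InRange m j = 1 ≤ j × j ≤ m

CorrectUpTo : ℕ → ℕ → Term → Term → Term → Set
CorrectUpTo m i cs us ds =
  m ≤ i
  × DistinctList cs
  × (∀ j → InRange m j → Member (num j) cs)
  × (∀ j j' k k' → InRange m j → InRange m j' → j ≢ j'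
       → KthMember k (num j) cs → KthMember k' (num j') cs
       → upDiag k j i ≢ upDiag k' j' i × downDiag k j i ≢ downDiag k' j' i)
  × (∀ j k → InRange m j → KthMember k (num j) cs
       → (∀ l → 0 < l → upDiag k j i ≡ + l → KthMember l (num j) us)
       × (∀ l → 0 < l → downDiag k j i ≡ + l → KthMember l (num j) ds))

S : Atom → Set
S (pq i c u d) = Σ ℕ λ k →
  KthMember (suc k) i c × KthMember (suc k) i u × KthMember (suc k) i d
S (pqs a cs us x) =
  (a ≡ z)
  ⊎ (Σ ℕ λ i → 0 < i × a ≡ num i ×
      (Σ Term λ t → Σ Term λ ds → x ≡ cons t ds ×
        (∀ j → InRange i j → Member (num j) cs) ×
        (DistinctList cs → CorrectUpTo i i cs us ds)))

module Submission where

-- The proof is an induction on derivations in the least Herbrand model.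
-- For  pq  the position k of i in the three lists is carried along.  We name the core of the
-- notion "correct up to m w.r.t. i" (membership, distinct diagonals and the
-- diagonal lists recording the queens) as the record  Placed , and prove:
--   * shifting: dropping the head of the up-diagonal list and consing a new
--     head onto the down-diagonal list turns placement w.r.t. i into
--     placement w.r.t. i+1 (up diagonals decrease by one, down ones increase);
--   * extension: if i+1 sits at the same position k in cs, us and ds (the
--     pq specification), then a placement of 1..i w.r.t. i+1 extends to one
--     of 1..i+1, provided cs has distinct members.

open import Defs
open import Data.Nat as ℕ using (ℕ; zero; suc; _≤_; _<_; _∸_; z≤n; s≤s)
import Data.Nat.Properties as ℕP
open import Data.Integer as ℤ using (+_)
import Data.Integer.Properties as ℤP
open import Data.Integer.Tactic.RingSolver using (solve-∀)
open import Data.Product using (Σ; _×_; _,_)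
open import Data.Sum using (_⊎_; inj₁; inj₂)
open import Data.Empty using (⊥-elim)
open import Relation.Nullary using (¬_; yes; no; contradiction)
open import Relation.Binary.PropositionalEquality
  using (_≡_; _≢_; refl; sym; trans; cong; subst; module ≡-Reasoning)

kthMember-functional : ∀ {k e e' t} → KthMember k e t → KthMember k e' t → e ≡ e'
kthMember-functional (here e t)  (here .e .t)  = refl
kthMember-functional (there x at) (there .x at') = kthMember-functional at at'

kthMember-pos : ∀ {k e t} → KthMember k e t → 0 < k
kthMember-pos (here e t)  = s≤s z≤n
kthMember-pos (there x at) = s≤s z≤n

kthMember-tail : ∀ {l e x t} → 0 < l → KthMember (suc l) e (cons x t) → KthMember l e t
kthMember-tail ()  (here _ _)
kthMember-tail l>0 (there _ at) = at

distinct-position : ∀ {cs k k' e} → DistinctList cs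
                  → KthMember k e cs → KthMember k' e cs → k ≡ k'
distinct-position {k = k} {k'} (_ , distinct) at at' with k ℕ.≟ k'
... | yes k≡k' = k≡k'
... | no  k≢k' = contradiction refl (distinct k k' _ _ at at' k≢k')

num-injective : ∀ {a b} → num a ≡ num b → a ≡ b
num-injective {zero}  {zero}  refl = refl
num-injective {suc a} {suc b} e = cong suc (num-injective (cong predecessor e))
  where predecessor : Term → Term
        predecessor (s t) = t
        predecessor t     = t

no-InRange-0 : ∀ {j} → ¬ InRange 0 j
no-InRange-0 (s≤s _ , ())

InRange-suc : ∀ {i j} → InRange (suc i) j → InRange i j ⊎ j ≡ suc i
InRange-suc (1≤j , j≤i+1) with ℕP.m≤n⇒m<n∨m≡n j≤i+1
... | inj₁ j<i+1  = inj₁ (1≤j , ℕP.≤-pred j<i+1)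
... | inj₂ j≡i+1 = inj₂ j≡i+1

members-suc : ∀ {i k cs} → (∀ j → InRange i j → Member (num j) cs)
            → KthMember k (num (suc i)) cs
            → ∀ j → InRange (suc i) j → Member (num j) cs
members-suc members at j r with InRange-suc r
... | inj₁ r'   = members j r'
... | inj₂ refl = _ , at

sucℤ-injective : ∀ {a b} → ℤ.suc a ≡ ℤ.suc b → a ≡ b
sucℤ-injective {a} {b} e = begin
  a                    ≡⟨ sym (ℤP.pred-suc a) ⟩
  ℤ.pred (ℤ.suc a)     ≡⟨ cong ℤ.pred e ⟩
  ℤ.pred (ℤ.suc b)     ≡⟨ ℤP.pred-suc b ⟩
  b                    ∎
  where open ≡-Reasoning

minus-nat : ∀ a b → b ≤ a → + a ℤ.- + b ≡ + (a ∸ b)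
minus-nat a b b≤a = trans (ℤP.m-n≡m⊖n a b) (ℤP.⊖-≥ b≤a)

upDiag-suc : ∀ k j i → upDiag k j i ≡ ℤ.suc (upDiag k j (suc i))
upDiag-suc k j i = shift (+ k) (+ j) (+ i)
  where shift : ∀ K J I → (K ℤ.+ J) ℤ.- I ≡ + 1 ℤ.+ ((K ℤ.+ J) ℤ.- (+ 1 ℤ.+ I))
        shift = solve-∀

downDiag-suc : ∀ k j i → downDiag k j (suc i) ≡ ℤ.suc (downDiag k j i)
downDiag-suc k j i = shift (+ k) (+ j) (+ i)
  where shift : ∀ K J I → (K ℤ.+ (+ 1 ℤ.+ I)) ℤ.- J ≡ + 1 ℤ.+ ((K ℤ.+ I) ℤ.- J)
        shift = solve-∀

upDiag-self : ∀ k i → upDiag k i i ≡ + k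
upDiag-self k i =
  trans (minus-nat (k ℕ.+ i) i (ℕP.m≤n+m i k)) (cong +_ (ℕP.m+n∸n≡m k i))

downDiag-self : ∀ k i → downDiag k i i ≡ + k
downDiag-self = upDiag-self

downDiag-earlier : ∀ {k j i} → 0 < k → j ≤ i
                 → Σ ℕ λ d → 0 < d × downDiag k j i ≡ + d
downDiag-earlier {k} {j} {i} k>0 j≤i =
  (k ℕ.+ i) ∸ j , ℕP.m<n⇒0<n∸m j<k+i , minus-nat (k ℕ.+ i) j (ℕP.<⇒≤ j<k+i)
  where j<k+i : j < k ℕ.+ i
        j<k+i = ℕP.≤-<-trans j≤i (ℕP.m<n+m i k>0)

-- The part of "correct up to m w.r.t. i" that is not about cs being a list
-- of distinct members.
record Placed (m i : ℕ) (cs us ds : Term) : Set where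
  field
    members   : ∀ j → InRange m j → Member (num j) cs
    diagonals : ∀ j j' k k' → InRange m j → InRange m j' → j ≢ j'
              → KthMember k (num j) cs → KthMember k' (num j') cs
              → upDiag k j i ≢ upDiag k' j' i × downDiag k j i ≢ downDiag k' j' i
    onUp      : ∀ j k → InRange m j → KthMember k (num j) cs
              → ∀ l → 0 < l → upDiag k j i ≡ + l → KthMember l (num j) us
    onDown    : ∀ j k → InRange m j → KthMember k (num j) cs
              → ∀ l → 0 < l → downDiag k j i ≡ + l → KthMember l (num j) ds

placed-zero : ∀ {i cs us ds} → Placed 0 i cs us ds
placed-zero = record
  { members   = λ _ r → ⊥-elim (no-InRange-0 r)
  ; diagonals = λ _ _ _ _ r → ⊥-elim (no-InRange-0 r)
  ; onUp      = λ _ _ r → ⊥-elim (no-InRange-0 r)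
  ; onDown    = λ _ _ r → ⊥-elim (no-InRange-0 r)
  }

fromCorrectUpTo : ∀ {m i cs us ds} → CorrectUpTo m i cs us ds → Placed m i cs us ds
fromCorrectUpTo (_ , _ , members , diagonals , lists) = record
  { members   = members
  ; diagonals = diagonals
  ; onUp      = λ j k r at → let (up , _) = lists j k r at in up
  ; onDown    = λ j k r at → let (_ , down) = lists j k r at in down
  }

toCorrectUpTo : ∀ {m i cs us ds} → m ≤ i → DistinctList cs
              → Placed m i cs us ds → CorrectUpTo m i cs us ds
toCorrectUpTo m≤i distinct P =
  m≤i , distinct , members , diagonals , λ j k r at → onUp j k r at , onDown j k r at
  where open Placed P

shift : ∀ {m i cs x us t ds} → m ≤ i
      → Placed m i cs (cons x us) ds → Placed m (suc i) cs us (cons t ds)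
shift {m} {i} {cs} {x} {us} {t} {ds} m≤i P = record
  { members   = members
  ; diagonals = diagonals′
  ; onUp      = onUp′
  ; onDown    = onDown′
  }
  where
    open Placed P

    diagonals′ : ∀ j j' k k' → InRange m j → InRange m j' → j ≢ j'
               → KthMember k (num j) cs → KthMember k' (num j') cs
               → upDiag k j (suc i) ≢ upDiag k' j' (suc i)
                 × downDiag k j (suc i) ≢ downDiag k' j' (suc i)
    diagonals′ j j' k k' r r' j≢j' at at' =
      let (up≢ , down≢) = diagonals j j' k k' r r' j≢j' at at'
      in (λ e → up≢ (trans (upDiag-suc k j i)
                       (trans (cong ℤ.suc e) (sym (upDiag-suc k' j' i)))))
       , (λ e → down≢ (sucℤ-injective (trans (sym (downDiag-suc k j i))
                         (trans e (downDiag-suc k' j' i)))))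

    onUp′ : ∀ j k → InRange m j → KthMember k (num j) cs
          → ∀ l → 0 < l → upDiag k j (suc i) ≡ + l → KthMember l (num j) us
    onUp′ j k r at l l>0 e = kthMember-tail l>0
      (onUp j k r at (suc l) (s≤s z≤n) (trans (upDiag-suc k j i) (cong ℤ.suc e)))

    onDown′ : ∀ j k → InRange m j → KthMember k (num j) cs
            → ∀ l → 0 < l → downDiag k j (suc i) ≡ + l → KthMember l (num j) (cons t ds)
    onDown′ j k r@(_ , j≤m) at l _ e
      with downDiag-earlier (kthMember-pos at) (ℕP.≤-trans j≤m m≤i)
    ... | d , d>0 , eᵢ = subst (λ l → KthMember l (num j) (cons t ds)) suc-d≡l
                           (there t (onDown j k r at d d>0 eᵢ))
      where suc-d≡l : suc d ≡ l
            suc-d≡l = ℤP.+-injective (trans (cong ℤ.suc (sym eᵢ))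
                        (trans (sym (downDiag-suc k j i)) e))

module Extension {i k cs us ds} (distinct : DistinctList cs)
                 (P : Placed i (suc i) cs us ds)
                 (kc : KthMember (suc k) (num (suc i)) cs)
                 (ku : KthMember (suc k) (num (suc i)) us)
                 (kd : KthMember (suc k) (num (suc i)) ds) where
  open Placed P

  -- The new queen sits on up and down diagonal k+1 ...
  new-up : upDiag (suc k) (suc i) (suc i) ≡ + suc k
  new-up = upDiag-self (suc k) (suc i)

  new-down : downDiag (suc k) (suc i) (suc i) ≡ + suc k
  new-down = downDiag-self (suc k) (suc i)

  -- ... and no earlier queen shares a diagonal with it, since that queen
  -- would then be recorded at position k+1 of us (resp. ds) as well.
  new-vs-old : ∀ j k' → InRange i j → suc i ≢ j → KthMember k' (num j) cs
             → upDiag (suc k) (suc i) (suc i) ≢ upDiag k' j (suc i)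
               × downDiag (suc k) (suc i) (suc i) ≢ downDiag k' j (suc i)
  new-vs-old j k' r i+1≢j at =
      (λ e → i+1≢j (num-injective (kthMember-functional ku
               (onUp j k' r at (suc k) (s≤s z≤n) (trans (sym e) new-up)))))
    , (λ e → i+1≢j (num-injective (kthMember-functional kd
               (onDown j k' r at (suc k) (s≤s z≤n) (trans (sym e) new-down)))))

  diagonals′ : ∀ j j' k₁ k₁' → InRange (suc i) j → InRange (suc i) j' → j ≢ j'
             → KthMember k₁ (num j) cs → KthMember k₁' (num j') cs
             → upDiag k₁ j (suc i) ≢ upDiag k₁' j' (suc i)
               × downDiag k₁ j (suc i) ≢ downDiag k₁' j' (suc i)
  diagonals′ j j' k₁ k₁' r r' j≢j' at at' with InRange-suc r | InRange-suc r'
  ... | inj₁ rᵢ | inj₁ rᵢ' = diagonals j j' k₁ k₁' rᵢ rᵢ' j≢j' at at'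
  ... | inj₂ refl | inj₂ refl = contradiction refl j≢j'
  ... | inj₂ refl | inj₁ rᵢ'
    rewrite distinct-position distinct at kc = new-vs-old j' k₁' rᵢ' j≢j' at'
  ... | inj₁ rᵢ | inj₂ refl
    rewrite distinct-position distinct at' kc =
      let (up≢ , down≢) = new-vs-old j k₁ rᵢ (λ e → j≢j' (sym e)) at
      in (λ e → up≢ (sym e)) , (λ e → down≢ (sym e))

  onUp′ : ∀ j k₁ → InRange (suc i) j → KthMember k₁ (num j) cs
        → ∀ l → 0 < l → upDiag k₁ j (suc i) ≡ + l → KthMember l (num j) us
  onUp′ j k₁ r at l l>0 e with InRange-suc r
  ... | inj₁ rᵢ = onUp j k₁ rᵢ at l l>0 e
  ... | inj₂ refl rewrite distinct-position distinct at kc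
                        | ℤP.+-injective (trans (sym e) new-up) = ku

  onDown′ : ∀ j k₁ → InRange (suc i) j → KthMember k₁ (num j) cs
          → ∀ l → 0 < l → downDiag k₁ j (suc i) ≡ + l → KthMember l (num j) ds
  onDown′ j k₁ r at l l>0 e with InRange-suc r
  ... | inj₁ rᵢ = onDown j k₁ rᵢ at l l>0 e
  ... | inj₂ refl rewrite distinct-position distinct at kc
                        | ℤP.+-injective (trans (sym e) new-down) = kd

  extended : Placed (suc i) (suc i) cs us ds
  extended = record
    { members   = members-suc members kc
    ; diagonals = diagonals′
    ; onUp      = onUp′
    ; onDown    = onDown′
    }

pqs-premise : ∀ {a cs x us ds} → S (pqs a cs (cons x us) ds)
            → Σ ℕ λ i → a ≡ num i × (∀ j → InRange i j → Member (num j) cs)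
                      × (DistinctList cs → Placed i (suc i) cs us ds)
pqs-premise (inj₁ refl) = 0 , refl , (λ _ r → ⊥-elim (no-InRange-0 r)) , λ _ → placed-zero
pqs-premise (inj₂ (i , _ , refl , t , ds , refl , members , correct)) =
  i , refl , members , λ distinct → shift ℕP.≤-refl (fromCorrectUpTo (correct distinct))

-- Induction on the derivation; the recursive pqs clause combines the
-- shifted premise with the pq premise by extension.
mainTheorem2 : ∀ (a : Atom) → M a → S a
mainTheorem2 _ (pq-fact i c u d) = 0 , here i c , here i u , here i d
mainTheorem2 _ (pq-rule i x cs y us w ds m) with mainTheorem2 _ m
... | k , kc , ku , kd = suc k , there x kc , there y ku , there w kd
mainTheorem2 _ (pqs-fact a b c) = inj₁ refl
mainTheorem2 _ (pqs-rule _ cs us ds x y m₁ m₂)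
  with pqs-premise (mainTheorem2 _ m₁) | mainTheorem2 _ m₂
... | i , refl , members , placed | k , kc , ku , kd =
  inj₂ (suc i , s≤s z≤n , refl , y , ds , refl , members-suc members kc ,
        λ distinct → toCorrectUpTo ℕP.≤-refl distinct
                       (Extension.extended distinct (placed distinct) kc ku kd))
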